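{- For all formulas $\varphi,\psi$, the formula $\gamma(\varphi,\psi)\to\Diamond\varphi$ is a theorem of $\mathsf{ALR}$.
   Context: Formulas: $\varphi ::= p \mid \neg\varphi \mid \varphi\wedge\varphi \mid \Box\varphi \mid \gamma(\varphi,\varphi)$; $\vee,\to,\top$ abbreviations, $\Diamond\varphi:=\neg\Box\neg\varphi$. The logic $\mathsf{ALR}$ consists of all propositional tautologies, Modus Ponens, the $\mathsf{S4}$ axioms and rules for $\Box$, together with: Axiom 1: $\psi\vee(\varphi\wedge\gamma(\varphi,\psi))\to\Box(\varphi\to\gamma(\varphi,\psi))$; Axiom 2: $\Diamond(\varphi\wedge\gamma(\varphi,\psi))\to\gamma(\varphi,\psi)$; Rule 1: from $\varphi\to\varphi'$ and $\psi\to\psi'$ infer $\gamma(\varphi,\psi)\to\gamma(\varphi',\psi')$; Rule 2: from $\psi\to\Box(\varphi\to\psi)$ and $\varphi\wedge\Diamond(\varphi\wedge\psi)\to\psi$ infer $\gamma(\varphi,\psi)\to\Diamond(\varphi\wedge\psi)$. -}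

module Defs where

open import Data.Nat using (ℕ)
open import Data.Bool using (Bool; true; false; not; _∧_)
open import Relation.Binary.PropositionalEquality using (_≡_)

infixr 6 _∧'_
data Formula : Set where
  var  : ℕ → Formula
  ¬'_  : Formula → Formula
  _∧'_ : Formula → Formula → Formula
  □_   : Formula → Formula
  γ    : Formula → Formula → Formula

infixr 5 _∨'_
infixr 4 _⇒_
_∨'_ : Formula → Formula → Formula
φ ∨' ψ = ¬' (¬' φ ∧' ¬' ψ)

_⇒_ : Formula → Formula → Formula
φ ⇒ ψ = ¬' (φ ∧' ¬' ψ)

⊤' : Formula
⊤' = ¬' (var 0 ∧' ¬' var 0)

◇_ : Formula → Formula
◇ φ = ¬' (□ (¬' φ))

-- Classical truth-functional evaluation, treating variables, □-formulas and
-- γ-formulas as propositional atoms (valued by v).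
eval : (Formula → Bool) → Formula → Bool
eval v (var p)   = v (var p)
eval v (¬' φ)    = not (eval v φ)
eval v (φ ∧' ψ)  = eval v φ ∧ eval v ψ
eval v (□ φ)     = v (□ φ)
eval v (γ φ ψ)   = v (γ φ ψ)

Tautology : Formula → Set
Tautology φ = (v : Formula → Bool) → eval v φ ≡ true

data ALR⊢_ : Formula → Set where
  taut  : ∀ {φ} → Tautology φ → ALR⊢ φ
  mp    : ∀ {φ ψ} → ALR⊢ (φ ⇒ ψ) → ALR⊢ φ → ALR⊢ ψ
  axK   : ∀ {φ ψ} → ALR⊢ (□ (φ ⇒ ψ) ⇒ (□ φ ⇒ □ ψ))
  axT   : ∀ {φ} → ALR⊢ (□ φ ⇒ φ)
  ax4   : ∀ {φ} → ALR⊢ (□ φ ⇒ □ (□ φ))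
  nec   : ∀ {φ} → ALR⊢ φ → ALR⊢ (□ φ)
  ax1   : ∀ {φ ψ} → ALR⊢ ((ψ ∨' (φ ∧' γ φ ψ)) ⇒ □ (φ ⇒ γ φ ψ))
  ax2   : ∀ {φ ψ} → ALR⊢ (◇ (φ ∧' γ φ ψ) ⇒ γ φ ψ)
  rule1 : ∀ {φ φ' ψ ψ'} → ALR⊢ (φ ⇒ φ') → ALR⊢ (ψ ⇒ ψ')
        → ALR⊢ (γ φ ψ ⇒ γ φ' ψ')
  rule2 : ∀ {φ ψ} → ALR⊢ (ψ ⇒ □ (φ ⇒ ψ)) → ALR⊢ ((φ ∧' ◇ (φ ∧' ψ)) ⇒ ψ)
        → ALR⊢ (γ φ ψ ⇒ ◇ (φ ∧' ψ))

{-# OPTIONS --safe #-}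
-- Weakening the second argument of γ to a theorem ⊤' makes both premises of
-- Rule 2 trivially derivable, so γ(φ,ψ) → γ(φ,⊤') → ◇(φ ∧ ⊤') → ◇φ.
module Submission where

open import Defs
open import Data.Bool using (true; false)
open import Relation.Binary.PropositionalEquality using (refl)

⊤'-tautology : Tautology ⊤'
⊤'-tautology v with v (var 0)
... | true  = refl
... | false = refl

refl-tautology : (A : Formula) → Tautology (A ⇒ A)
refl-tautology A v with eval v A
... | false = refl
... | true  = refl

const-tautology : (A B : Formula) → Tautology (A ⇒ (B ⇒ A))
const-tautology A B v with eval v A | eval v B
... | false | _     = refl
... | true  | true  = refl
... | true  | false = refl

∧-elimˡ-tautology : (A B : Formula) → Tautology ((A ∧' B) ⇒ A)
∧-elimˡ-tautology A B v with eval v A | eval v B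
... | false | _     = refl
... | true  | true  = refl
... | true  | false = refl

trans-tautology : (A B C : Formula) → Tautology ((A ⇒ B) ⇒ ((B ⇒ C) ⇒ (A ⇒ C)))
trans-tautology A B C v with eval v A | eval v B | eval v C
... | false | false | _     = refl
... | false | true  | false = refl
... | false | true  | true  = refl
... | true  | false | _     = refl
... | true  | true  | false = refl
... | true  | true  | true  = refl

contraposition-tautology : (A B : Formula) → Tautology ((A ⇒ B) ⇒ (¬' B ⇒ ¬' A))
contraposition-tautology A B v with eval v A | eval v B
... | false | false = refl
... | false | true  = refl
... | true  | true  = refl
... | true  | false = refl

⊢⊤' : ALR⊢ ⊤'
⊢⊤' = taut ⊤'-tautology

⇒-refl : ∀ {A} → ALR⊢ (A ⇒ A)
⇒-refl {A} = taut (refl-tautology A)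

⇒-const : ∀ {A B} → ALR⊢ B → ALR⊢ (A ⇒ B)
⇒-const {A} {B} ⊢B = mp (taut (const-tautology B A)) ⊢B

⇒-trans : ∀ {A B C} → ALR⊢ (A ⇒ B) → ALR⊢ (B ⇒ C) → ALR⊢ (A ⇒ C)
⇒-trans {A} {B} {C} A⇒B B⇒C = mp (mp (taut (trans-tautology A B C)) A⇒B) B⇒C

⇒-contraposition : ∀ {A B} → ALR⊢ (A ⇒ B) → ALR⊢ (¬' B ⇒ ¬' A)
⇒-contraposition {A} {B} = mp (taut (contraposition-tautology A B))

◇-mono : ∀ {A B} → ALR⊢ (A ⇒ B) → ALR⊢ (◇ A ⇒ ◇ B)
◇-mono A⇒B = ⇒-contraposition (mp axK (nec (⇒-contraposition A⇒B)))

γ-monoʳ : ∀ {φ ψ ψ'} → ALR⊢ (ψ ⇒ ψ') → ALR⊢ (γ φ ψ ⇒ γ φ ψ')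
γ-monoʳ = rule1 ⇒-refl

γ-theorem⇒◇∧ : ∀ {φ τ} → ALR⊢ τ → ALR⊢ (γ φ τ ⇒ ◇ (φ ∧' τ))
γ-theorem⇒◇∧ ⊢τ = rule2 (⇒-const (nec (⇒-const ⊢τ))) (⇒-const ⊢τ)

mainTheorem10 : (φ ψ : Formula) → ALR⊢ (γ φ ψ ⇒ ◇ φ)
mainTheorem10 φ _ =
  ⇒-trans (γ-monoʳ (⇒-const ⊢⊤'))
    (⇒-trans (γ-theorem⇒◇∧ ⊢⊤')
      (◇-mono (taut (∧-elimˡ-tautology φ ⊤'))))
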